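{- Box-diamond automata are less expressive than EU-automata: every language of $\Sigma$-labelled trees accepted by a box-diamond automaton is accepted by some AAPTA, and there is an AAPTA whose language is accepted by no box-diamond automaton.
   Context: Automata: an EU-pair $\langle E;U\rangle$ over $S$ ($E$ a finite multiset over $S$, $U\subseteq S$) is satisfied by a multiset $\mu:S\to\mathbb{N}$ if $E\sqsubseteq\mu$ pointwise and every $s$ with $\mu(s)>E(s)$ belongs to $U$. A marking $\nu:S'\to 2^S$ satisfies $\langle E;U\rangle$ if some choice function $\nu'(s')\in\nu(s')$ has image multiset $s\mapsto|\{s':\nu'(s')=s\}|$ satisfying it; extended to positive boolean formulas over EU-pairs ($\top,\bot,\wedge,\vee$). An AAPTA (EU-automaton) over $\Sigma$ is $\langle Q,q_0,\delta,\omega\rangle$ with $\delta(q,\sigma)$ a positive boolean formula over EU-pairs over $Q$ and priorities $\omega:Q\to\mathbb{N}$. Trees: $t\subseteq D^*$ prefix-closed ($D$ any finite set), $\Sigma$-labelled via $l:t\to\Sigma$. An execution tree over $(t,l)$ is a $(D\times Q)$-tree, node $(d_1,q_1)\cdots(d_k,q_k)$ labelled $(d_1\cdots d_k,q_k)$, root $(\varepsilon,q_0)$, such that for each node $x$ labelled $(m,q)$ the marking $m\cdot d\mapsto\{q':x\cdot(d,q')\text{ is a node}\}$ satisfies $\delta(q,l(m))$; accepting if on every infinite branch the least priority seen infinitely often is even; the language is the set of trees with an accepting execution tree. Box-diamond automata are the AAPTAs having a state $q_\top$ from which every tree is accepted and in which every EU-pair occurring in the transition function is of the form $\langle\{\!\{q\mapsto1\}\!\};\{q_\top\}\rangle$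 ("some successor is explored in state $q$") or $\langle\emptyset;\{q\}\rangle$ ("all successors are explored in state $q$"). -}

module Defs where

open import Data.Nat using (ℕ; zero; suc; _≤_; _<_; _+_)
open import Data.Nat.Divisibility using (_∣_)
open import Data.Bool using (Bool; true; false; T; _∧_; if_then_else_)
open import Data.Fin using (Fin; zero; suc; _≟_)
open import Data.List using (List; []; _∷_; _∷ʳ_; map)
open import Data.Product using (Σ; ∃; _×_; _,_; proj₁; proj₂)
open import Data.Sum using (_⊎_)
open import Data.Unit using (⊤)
open import Data.Empty using (⊥)
open import Relation.Nullary.Decidable using (⌊_⌋)
open import Relation.Binary.PropositionalEquality using (_≡_)

record Tree (n : ℕ) : Set where
  field
    mem    : List (Fin n) → Bool
    root   : T (mem [])
    closed : ∀ xs d → T (mem (xs ∷ʳ d)) → T (mem xs)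
open Tree public

-- A Σ-labelling (only its values on nodes of t matter)
Labelling : (Σ' : Set) (n : ℕ) → Set
Labelling Σ' n = List (Fin n) → Σ'

data PBF (A : Set) : Set where
  atom : A → PBF A
  tt   : PBF A
  ff   : PBF A
  _∧ᶠ_ : PBF A → PBF A → PBF A
  _∨ᶠ_ : PBF A → PBF A → PBF A

record EU (m : ℕ) : Set where
  constructor ⟨_⨾_⟩
  field
    E : Fin m → ℕ
    U : Fin m → Bool
open EU public

SatMS : ∀ {m} → (Fin m → ℕ) → EU m → Set
SatMS μ e = ∀ s → (E e s ≤ μ s) × (E e s < μ s → T (U e s))

countFin : ∀ n → (Fin n → Bool) → ℕ
countFin zero    P = 0
countFin (suc n) P = (if P zero then 1 else 0) + countFin n (λ d → P (suc d))

-- A marking ν : S' → 2^S where S' = {d : child d = true} ⊆ Fin n,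
-- given by child : Fin n → Bool and ν : Fin n → Fin m → Bool.
SatMarkEU : ∀ {n m} → (Fin n → Bool) → (Fin n → Fin m → Bool) → EU m → Set
SatMarkEU {n} {m} child ν e =
  Σ (Fin n → Fin m) λ ν' →
    (∀ d → T (child d) → T (ν d (ν' d))) ×
    SatMS (λ s → countFin n (λ d → child d ∧ ⌊ ν' d ≟ s ⌋)) e

SatMark : ∀ {n m} → (Fin n → Bool) → (Fin n → Fin m → Bool) → PBF (EU m) → Set
SatMark child ν (atom e) = SatMarkEU child ν e
SatMark child ν tt       = ⊤
SatMark child ν ff       = ⊥
SatMark child ν (φ ∧ᶠ ψ) = SatMark child ν φ × SatMark child ν ψ
SatMark child ν (φ ∨ᶠ ψ) = SatMark child ν φ ⊎ SatMark child ν ψ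

record AAPTA (Σ' : Set) : Set where
  field
    m  : ℕ
    q₀ : Fin m
    δ  : Fin m → Σ' → PBF (EU m)
    ω  : Fin m → ℕ
open AAPTA public

-- state component of an execution-tree node (q for the root)
lastState : ∀ {n m} → Fin m → List (Fin n × Fin m) → Fin m
lastState q []            = q
lastState q (x ∷ [])      = proj₂ x
lastState q (x ∷ y ∷ xs)  = lastState q (y ∷ xs)

dirs : ∀ {n m} → List (Fin n × Fin m) → List (Fin n)
dirs = map proj₁

prefix : ∀ {A : Set} → (ℕ → A) → ℕ → List A
prefix f zero    = []
prefix f (suc k) = prefix f k ∷ʳ f k

record ExecTree {Σ' : Set} (A : AAPTA Σ') (q : Fin (m A)) {n : ℕ}
                (t : Tree n) (l : Labelling Σ' n) : Set where
  field
    node     : List (Fin n × Fin (m A)) → Bool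
    node-root   : T (node [])
    node-closed : ∀ xs y → T (node (xs ∷ʳ y)) → T (node xs)
    node-in-t   : ∀ xs → T (node xs) → T (mem t (dirs xs))
    node-trans  : ∀ xs → T (node xs) →
      SatMark (λ d → mem t (dirs xs ∷ʳ d))
              (λ d q' → node (xs ∷ʳ (d , q')))
              (δ A (lastState q xs) (l (dirs xs)))
open ExecTree public

IsBranch : ∀ {Σ' : Set} {A : AAPTA Σ'} {q n t l} → ExecTree A q {n} t l →
           (ℕ → Fin n × Fin (m A)) → Set
IsBranch X f = ∀ k → T (node X (prefix f k))

ParityOK : (ℕ → ℕ) → Set
ParityOK pr = ∀ p →
  (∀ N → ∃ λ i → (N ≤ i) × (pr i ≡ p)) →
  (∃ λ N → ∀ i → N ≤ i → p ≤ pr i) →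
  2 ∣ p

AcceptingExec : ∀ {Σ' : Set} {A : AAPTA Σ'} {q n t l} → ExecTree A q {n} t l → Set
AcceptingExec {A = A} X = ∀ f → IsBranch X f → ParityOK (λ i → ω A (proj₂ (f i)))

AcceptsFrom : ∀ {Σ' : Set} (A : AAPTA Σ') → Fin (m A) → ∀ {n} → Tree n → Labelling Σ' n → Set
AcceptsFrom A q t l = Σ (ExecTree A q t l) AcceptingExec

Accepts : ∀ {Σ' : Set} (A : AAPTA Σ') → ∀ {n} → Tree n → Labelling Σ' n → Set
Accepts A = AcceptsFrom A (q₀ A)

SameLanguage : ∀ {Σ' : Set} → AAPTA Σ' → AAPTA Σ' → Set
SameLanguage A B = ∀ n (t : Tree n) (l : Labelling _ n) →
  (Accepts A t l → Accepts B t l) × (Accepts B t l → Accepts A t l)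

indicator : ∀ {m} → Fin m → Fin m → Bool
indicator q s = ⌊ s ≟ q ⌋

AllAtoms : ∀ {A : Set} → (A → Set) → PBF A → Set
AllAtoms P (atom a) = P a
AllAtoms P tt       = ⊤
AllAtoms P ff       = ⊤
AllAtoms P (φ ∧ᶠ ψ) = AllAtoms P φ × AllAtoms P ψ
AllAtoms P (φ ∨ᶠ ψ) = AllAtoms P φ × AllAtoms P ψ

-- ⟨{{q ↦ 1}} ; {q⊤}⟩  or  ⟨∅ ; {q}⟩  (pointwise equality of E and U)
BoxDiamondPair : ∀ {m} → Fin m → EU m → Set
BoxDiamondPair qT e =
  (∃ λ q → (∀ s → E e s ≡ (if indicator q s then 1 else 0)) ×
           (∀ s → U e s ≡ indicator qT s))
  ⊎
  (∃ λ q → (∀ s → E e s ≡ 0) × (∀ s → U e s ≡ indicator q s))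

IsBoxDiamond : ∀ {Σ' : Set} → AAPTA Σ' → Set
IsBoxDiamond {Σ'} A = Σ (Fin (m A)) λ qT →
  (∀ n (t : Tree n) (l : Labelling Σ' n) → AcceptsFrom A qT t l) ×
  (∀ q (σ : Σ') → AllAtoms (BoxDiamondPair qT) (δ A q σ))

-- A box-diamond formula only asks whether some child, or every child, can be
-- run in a given state; it cannot count children.  Hence any run of a
-- box-diamond automaton on the tree whose root has two leaf children can be
-- folded onto the tree whose root has one leaf child, giving that child the
-- union of the states of the two original children.  The EU-automaton that
-- demands two children in a state accepting everything separates these trees.
module Submission where

open import Defs
open import Data.Nat using (ℕ; zero; suc; _≤_; _<_; z≤n; s≤s)
open import Data.Nat.Properties using (≤-refl; ≤-trans; <-≤-trans; m≤n+m; +-identityʳ)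
open import Data.Fin using (Fin; zero; suc; _≟_)
open import Data.Bool using (Bool; true; false; T; _∧_; _∨_; if_then_else_)
open import Data.Bool.Properties using (T-∧; T-∨)
open import Data.List using (List; []; _∷_; _∷ʳ_)
open import Data.Product using (Σ; ∃-syntax; _×_; _,_; proj₁; proj₂)
open import Data.Sum using (inj₁; inj₂)
open import Data.Unit using (tt)
open import Data.Empty using (⊥-elim)
open import Function using (Equivalence; id)
open import Relation.Nullary using (¬_; yes; no)
open import Relation.Nullary.Decidable using (⌊_⌋; toWitness; fromWitness)
open import Relation.Binary.PropositionalEquality using (_≡_; refl; sym; subst)

open Equivalence using (to; from)

boolToℕ : Bool → ℕ
boolToℕ b = if b then 1 else 0

boolToℕ≤1 : ∀ b → boolToℕ b ≤ 1
boolToℕ≤1 true  = ≤-refl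
boolToℕ≤1 false = z≤n

boolToℕ-pos⇒T : ∀ b → 0 < boolToℕ b → T b
boolToℕ-pos⇒T true _ = tt

countFin-pos⇒∃ : ∀ n (P : Fin n → Bool) → 0 < countFin n P → ∃[ d ] T (P d)
countFin-pos⇒∃ (suc n) P pos with P zero in eq
... | true  = zero , subst T (sym eq) tt
... | false = let d , Pd = countFin-pos⇒∃ n (λ d → P (suc d)) pos in suc d , Pd

T⇒countFin-pos : ∀ n (P : Fin n → Bool) d → T (P d) → 0 < countFin n P
T⇒countFin-pos (suc n) P zero Pd with P zero
... | true = s≤s z≤n
T⇒countFin-pos (suc n) P (suc d) Pd =
  <-≤-trans (T⇒countFin-pos n (λ d → P (suc d)) d Pd) (m≤n+m _ (boolToℕ (P zero)))

countFin-false : ∀ n → countFin n (λ _ → false) ≡ 0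
countFin-false zero    = refl
countFin-false (suc n) = countFin-false n

onlyZero : ∀ {n} → Fin (suc n) → Bool
onlyZero d = ⌊ d ≟ zero ⌋

countFin-onlyZero : ∀ n (P : Fin (suc n) → Bool) →
  countFin (suc n) (λ d → onlyZero d ∧ P d) ≡ boolToℕ (P zero)
countFin-onlyZero n P
  rewrite countFin-false n = +-identityʳ (boolToℕ (P zero))

SatMS-cong : ∀ {m} {μ μ' : Fin m → ℕ} {e} → (∀ s → μ s ≡ μ' s) → SatMS μ e → SatMS μ' e
SatMS-cong {e = e} μ≡μ' sat s =
  subst (λ k → (E e s ≤ k) × (E e s < k → T (U e s))) (μ≡μ' s) (sat s)

module _ {n m} {child : Fin n → Bool} {ν : Fin n → Fin m → Bool} {e : EU m} where

  SatMarkEU⇒occupied : SatMarkEU child ν e → ∀ q → 0 < E e q →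
    ∃[ d ] T (child d) × T (ν d q)
  SatMarkEU⇒occupied (ν' , ν'∈ν , sat) q pos =
    let d , chosen = countFin-pos⇒∃ n _ (<-≤-trans pos (proj₁ (sat q)))
        cd , ν'd≡q = to T-∧ chosen
    in d , cd , subst (λ s → T (ν d s)) (toWitness ν'd≡q) (ν'∈ν d cd)

  SatMarkEU⇒children-in-U : SatMarkEU child ν e → (∀ s → E e s ≡ 0) →
    ∀ d → T (child d) → ∃[ s ] T (ν d s) × T (U e s)
  SatMarkEU⇒children-in-U (ν' , ν'∈ν , sat) E≡0 d cd =
    ν' d , ν'∈ν d cd , proj₂ (sat (ν' d)) E<count
    where
    E<count : E e (ν' d) < _
    E<count = subst (_< _) (sym (E≡0 (ν' d)))
      (T⇒countFin-pos n _ d (from T-∧ (cd , fromWitness refl)))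

SatMark-childless : ∀ {n m} (ν ν₁ : Fin n → Fin m → Bool) φ →
  SatMark (λ _ → false) ν φ → SatMark (λ _ → false) ν₁ φ
SatMark-childless ν ν₁ (atom e)  (ν' , _ , sat) = ν' , (λ _ ()) , sat
SatMark-childless ν ν₁ tt       _            = tt
SatMark-childless ν ν₁ (φ ∧ᶠ ψ)  (sφ , sψ)    =
  SatMark-childless ν ν₁ φ sφ , SatMark-childless ν ν₁ ψ sψ
SatMark-childless ν ν₁ (φ ∨ᶠ ψ)  (inj₁ sφ)    = inj₁ (SatMark-childless ν ν₁ φ sφ)
SatMark-childless ν ν₁ (φ ∨ᶠ ψ)  (inj₂ sψ)    = inj₂ (SatMark-childless ν ν₁ ψ sψ)

module _ {m} {qT : Fin m} {e : EU m} where

  pairState : BoxDiamondPair qT e → Fin m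
  pairState (inj₁ (q , _)) = q
  pairState (inj₂ (q , _)) = q

  singleton-satisfies : (p : BoxDiamondPair qT e) → SatMS (λ s → boolToℕ ⌊ pairState p ≟ s ⌋) e
  singleton-satisfies (inj₁ (q , E≡ , _)) s rewrite E≡ s with q ≟ s | s ≟ q
  ... | yes _   | yes _   = ≤-refl , λ { (s≤s ()) }
  ... | no _    | no _    = z≤n , λ ()
  ... | yes q≡s | no s≢q  = ⊥-elim (s≢q (sym q≡s))
  ... | no q≢s  | yes s≡q = ⊥-elim (q≢s (sym s≡q))
  singleton-satisfies (inj₂ (q , E≡ , U≡)) s rewrite E≡ s | U≡ s =
    z≤n , λ pos → fromWitness (sym (toWitness (boolToℕ-pos⇒T ⌊ q ≟ s ⌋ pos)))

  -- For a box pair, this needs the marking to have at least one child.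
  BoxDiamondPair-occupied : (p : BoxDiamondPair qT e) →
    ∀ {n} {child : Fin n → Bool} {ν} → SatMarkEU child ν e →
    ∀ d₀ → T (child d₀) → ∃[ d ] T (child d) × T (ν d (pairState p))
  BoxDiamondPair-occupied (inj₁ (q , E≡ , _)) sat _ _ =
    SatMarkEU⇒occupied sat q (subst (0 <_) (sym E≡q≡1) (s≤s z≤n))
    where
    E≡q≡1 : E e q ≡ 1
    E≡q≡1 rewrite E≡ q with q ≟ q
    ... | yes _   = refl
    ... | no q≢q  = ⊥-elim (q≢q refl)
  BoxDiamondPair-occupied (inj₂ (q , E≡0 , U≡)) {ν = ν} sat d₀ cd₀
    with SatMarkEU⇒children-in-U sat E≡0 d₀ cd₀
  ... | s , νs , Us = d₀ , cd₀ , subst (λ s → T (ν d₀ s)) s≡q νs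
    where
    s≡q : s ≡ q
    s≡q = toWitness (subst T (U≡ s) Us)

module _ {n n' m} {child : Fin n → Bool} {ν : Fin n → Fin m → Bool}
         {ν₁ : Fin (suc n') → Fin m → Bool} (qT : Fin m) (d₀ : Fin n) (cd₀ : T (child d₀))
         (covers : ∀ d q → T (child d) → T (ν d q) → T (ν₁ zero q)) where

  SatMark-merge : ∀ φ → AllAtoms (BoxDiamondPair qT) φ →
    SatMark child ν φ → SatMark onlyZero ν₁ φ
  SatMark-merge (atom e) p sat =
    (λ _ → q) , chosen∈ν₁ ,
    SatMS-cong (λ s → sym (countFin-onlyZero n' (λ _ → ⌊ q ≟ s ⌋))) (singleton-satisfies p)
    where
    q : Fin m
    q = pairState p
    chosen∈ν₁ : ∀ d → T (onlyZero d) → T (ν₁ d q)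
    chosen∈ν₁ zero _ =
      let d , cd , νdq = BoxDiamondPair-occupied p {ν = ν} sat d₀ cd₀ in covers d q cd νdq
  SatMark-merge tt       _         _         = tt
  SatMark-merge (φ ∧ᶠ ψ) (pφ , pψ) (sφ , sψ) = SatMark-merge φ pφ sφ , SatMark-merge ψ pψ sψ
  SatMark-merge (φ ∨ᶠ ψ) (pφ , _)  (inj₁ sφ) = inj₁ (SatMark-merge φ pφ sφ)
  SatMark-merge (φ ∨ᶠ ψ) (_ , pψ)  (inj₂ sψ) = inj₂ (SatMark-merge ψ pψ sψ)

starMem : ∀ {n} → (Fin n → Bool) → List (Fin n) → Bool
starMem c []          = true
starMem c (d ∷ [])    = c d
starMem c (_ ∷ _ ∷ _) = false

star : ∀ {n} → (Fin n → Bool) → Tree n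
star c = record { mem = starMem c ; root = tt ; closed = prefixClosed }
  where
  prefixClosed : ∀ xs d → T (starMem c (xs ∷ʳ d)) → T (starMem c xs)
  prefixClosed []          _ _  = tt
  prefixClosed (_ ∷ [])    _ ()
  prefixClosed (_ ∷ _ ∷ _) _ ()

twoLeaves : Tree 2
twoLeaves = star (λ _ → true)

oneLeaf : Tree 2
oneLeaf = star onlyZero

ExecTree-star-accepting : ∀ {Σ'} {A : AAPTA Σ'} {q n} {c : Fin n → Bool} {l}
  (X : ExecTree A q (star c) l) → AcceptingExec X
ExecTree-star-accepting X f branch = ⊥-elim (node-in-t X (prefix f 2) (branch 2))

module _ {Σ'} (B : AAPTA Σ') (σ : Σ') where

  private
    Node : Set
    Node = List (Fin 2 × Fin (m B))

  foldChildren : (Node → Bool) → Node → Bool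
  foldChildren x []                  = true
  foldChildren x (_ ∷ _ ∷ _)         = false
  foldChildren x ((zero , q) ∷ [])   = x ((zero , q) ∷ []) ∨ x ((suc zero , q) ∷ [])
  foldChildren x ((suc _ , _) ∷ [])  = false

  BoxDiamond-twoLeaves⇒oneLeaf : IsBoxDiamond B →
    Accepts B twoLeaves (λ _ → σ) → Accepts B oneLeaf (λ _ → σ)
  BoxDiamond-twoLeaves⇒oneLeaf (qT , _ , boxDiamond) (X , _) =
    folded , ExecTree-star-accepting folded
    where
    x = node X

    covers : ∀ d q → T true → T (x ((d , q) ∷ [])) → T (foldChildren x ((zero , q) ∷ []))
    covers zero       q _ h = from T-∨ (inj₁ h)
    covers (suc zero) q _ h = from T-∨ (inj₂ h)

    nodeClosed : ∀ xs y → T (foldChildren x (xs ∷ʳ y)) → T (foldChildren x xs)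
    nodeClosed []          _ _  = tt
    nodeClosed (_ ∷ [])    _ ()
    nodeClosed (_ ∷ _ ∷ _) _ ()

    inTree : ∀ xs → T (foldChildren x xs) → T (mem oneLeaf (dirs xs))
    inTree []                  _  = tt
    inTree ((zero , _) ∷ [])   _  = tt
    inTree ((suc _ , _) ∷ [])  ()
    inTree (_ ∷ _ ∷ _)         ()

    trans : ∀ xs → (h : T (foldChildren x xs)) →
      SatMark (λ d → mem oneLeaf (dirs xs ∷ʳ d))
              (λ d q' → foldChildren x (xs ∷ʳ (d , q')))
              (δ B (lastState (q₀ B) xs) σ)
    trans [] _ = SatMark-merge qT zero tt covers _ (boxDiamond (q₀ B) σ)
                   (node-trans X [] (node-root X))
    trans ((zero , q) ∷ []) h with to T-∨ h
    ... | inj₁ h₀ = SatMark-childless _ _ _ (node-trans X ((zero , q) ∷ []) h₀)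
    ... | inj₂ h₁ = SatMark-childless _ _ _ (node-trans X ((suc zero , q) ∷ []) h₁)
    trans ((suc _ , _) ∷ []) ()
    trans (_ ∷ _ ∷ _)        ()

    folded : ExecTree B (q₀ B) oneLeaf (λ _ → σ)
    folded = record
      { node        = foldChildren x
      ; node-root   = tt
      ; node-closed = nodeClosed
      ; node-in-t   = inTree
      ; node-trans  = trans
      }

atLeastTwoChildren : ∀ {Σ'} → AAPTA Σ'
atLeastTwoChildren = record { m = 2 ; q₀ = zero ; δ = δ₂ ; ω = λ _ → 0 }
  where
  twoInState1 : Fin 2 → ℕ
  twoInState1 zero    = 0
  twoInState1 (suc _) = 2

  δ₂ : Fin 2 → _ → PBF (EU 2)
  δ₂ zero    _ = atom ⟨ twoInState1 ⨾ (λ _ → true) ⟩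
  δ₂ (suc _) _ = tt

atLeastTwoChildren-accepts-twoLeaves : ∀ {Σ'} (l : Labelling Σ' 2) →
  Accepts atLeastTwoChildren twoLeaves l
atLeastTwoChildren-accepts-twoLeaves l = run , ExecTree-star-accepting run
  where
  childrenInState1 : List (Fin 2 × Fin 2) → Bool
  childrenInState1 []                 = true
  childrenInState1 (_ ∷ _ ∷ _)        = false
  childrenInState1 ((_ , zero) ∷ [])  = false
  childrenInState1 ((_ , suc _) ∷ []) = true

  nodeClosed : ∀ xs y → T (childrenInState1 (xs ∷ʳ y)) → T (childrenInState1 xs)
  nodeClosed []          _ _  = tt
  nodeClosed (_ ∷ [])    _ ()
  nodeClosed (_ ∷ _ ∷ _) _ ()

  inTree : ∀ xs → T (childrenInState1 xs) → T (mem twoLeaves (dirs xs))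
  inTree []                 _  = tt
  inTree ((_ , suc _) ∷ []) _  = tt
  inTree ((_ , zero) ∷ [])  ()
  inTree (_ ∷ _ ∷ _)        ()

  trans : ∀ xs → T (childrenInState1 xs) →
    SatMark (λ d → mem twoLeaves (dirs xs ∷ʳ d))
            (λ d q → childrenInState1 (xs ∷ʳ (d , q)))
            (δ atLeastTwoChildren (lastState zero xs) (l (dirs xs)))
  trans [] _ = (λ _ → suc zero) , (λ _ _ → tt) , λ
    { zero       → z≤n , λ _ → tt
    ; (suc zero) → ≤-refl , λ _ → tt
    }
  trans ((_ , suc _) ∷ []) _ = tt
  trans ((_ , zero) ∷ [])  ()
  trans (_ ∷ _ ∷ _)        ()

  run : ExecTree atLeastTwoChildren zero twoLeaves l
  run = record
    { node        = childrenInState1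
    ; node-root   = tt
    ; node-closed = nodeClosed
    ; node-in-t   = inTree
    ; node-trans  = trans
    }

atLeastTwoChildren-rejects-oneLeaf : ∀ {Σ'} (l : Labelling Σ' 2) →
  ¬ Accepts atLeastTwoChildren oneLeaf l
atLeastTwoChildren-rejects-oneLeaf l (X , _)
  with node-trans X [] (node-root X)
... | ν' , _ , sat
  with ≤-trans (subst (2 ≤_) (countFin-onlyZero 1 (λ d → ⌊ ν' d ≟ suc zero ⌋))
                 (proj₁ (sat (suc zero))))
               (boolToℕ≤1 ⌊ ν' zero ≟ suc zero ⌋)
... | s≤s ()

lemma1 : (k : ℕ) →
    ((B : AAPTA (Fin (suc k))) → IsBoxDiamond B →
      Σ (AAPTA (Fin (suc k))) λ A → SameLanguage B A)
    ×
    (Σ (AAPTA (Fin (suc k))) λ A →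
      ¬ (Σ (AAPTA (Fin (suc k))) λ B → IsBoxDiamond B × SameLanguage A B))
lemma1 k = (λ B _ → B , λ _ _ _ → id , id) , atLeastTwoChildren , noBoxDiamond
  where
  l : Labelling (Fin (suc k)) 2
  l _ = zero

  noBoxDiamond : ¬ (Σ (AAPTA (Fin (suc k))) λ B →
                      IsBoxDiamond B × SameLanguage atLeastTwoChildren B)
  noBoxDiamond (B , boxDiamond , same) =
    atLeastTwoChildren-rejects-oneLeaf l
      (proj₂ (same 2 oneLeaf l)
        (BoxDiamond-twoLeaves⇒oneLeaf B zero boxDiamond
          (proj₁ (same 2 twoLeaves l) (atLeastTwoChildren-accepts-twoLeaves l))))
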